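{- Let $k\ge2$, $f:\binom{S}{k}\to\{0,1\}^k$, and let $\mathcal{A}$ be a strong $k'$-memory bounded probabilistic algorithm that uses $s$ samples and $q$ queries, executed on the input $U_f$. Then with probability at least $1-\frac{(k-k')sq}{m}$, for every set $A\in\binom{S}{k}$ the algorithm obtains at most $k'$ bits of $f(A)$.
   Context: Huge Object model: an algorithm receives samples $x^1,\dots,x^s$ drawn independently from the input distribution and may make queries $(i,j)$ returning the $j$-th bit of $x^i$. A deterministic strong $k'$-memory algorithm is a triple $(T,A,M)$: $T$ a decision tree (internal nodes labeled by queries, edges by answer bits), $A$ a set of accepting leaves, and $M$ assigns to each node a set $M(u)\subseteq[s]$ such that $|M(u)|\le k'$ for internal nodes, if $i\in M(u)$ and $v$ is a child of $u$ with $i\notin M(v)$ then $i\notin M(w)$ for all descendants $w$ of $v$, and the query $(i,j)$ at an internal node $u$ satisfies $i\in M(u)$; a probabilistic one is a distribution over such triples. Let $S=[m]$, $n=\binom{m-1}{k-1}$, $C:[m]\to\{0,1\}^n$ a systematic code (minimal normalized distance at least $\frac13$, codeword determined by its first $\lceil\log_2 m\rceil$ bits). For $a\in A\subseteq S$ let $\mathrm{ord}(a,A)=|\{a'\in A:a'\le a\}|$. $U_f$ is the distribution obtained by choosing $a\in S$ uniformly and outputting $C(a)$ followed by, for each $B\in\binom{S\setminus\{a\}}{k-1}$ in a fixed order, the bit $(f(B\cup\{a\}))_{\mathrm{ord}(a,B\cup\{a\})}$; such a string has key $a$. The algorithm obtains bit $\mathrm{ord}(a,A)$ of $f(A)$ when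 it queries, in a sample with key $a\in A$, the position corresponding to $B=A\setminus\{a\}$.
   Formalization: The probabilistic algorithm is a distribution over deterministic strong $k'$-memory algorithms whose probabilities are rational. -}

module Defs where

open import Data.Nat using (ℕ; zero; suc; _+_; _*_; _∸_; _≤_; _<_)
open import Data.Nat.Combinatorics using (_C_)
open import Data.Nat.Logarithm using (⌈log₂_⌉)
open import Data.Bool using (Bool; true; false) renaming (_≟_ to _≟ᵇ_)
open import Data.Fin using (Fin; toℕ)
open import Data.Fin.Subset using (Subset; _∈_; _∉_; _∩_; _∪_; _-_; ∣_∣; ⁅_⁆)
open import Data.Fin.Properties using (_≤?_)
open import Data.Vec using (Vec; []; _∷_; lookup; tabulate)
open import Data.List using (List; []; _∷_)
open import Data.List.Membership.Propositional using () renaming (_∈_ to _∈ₗ_)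
open import Data.Product using (_×_; _,_; ∃; Σ)
open import Data.Sum using (_⊎_; inj₁; inj₂)
open import Data.Unit using (⊤)
open import Data.Empty using (⊥)
open import Relation.Nullary using (¬_; yes; no)
open import Relation.Nullary.Decidable using (⌊_⌋)
open import Relation.Binary.PropositionalEquality using (_≡_; _≢_)
open import Function.Definitions using (Injective)

-- Ground set S = [m] is Fin m; subsets of S are Subset m.

nLen : ℕ → ℕ → ℕ
nLen m k = (m ∸ 1) C (k ∸ 1)

hamming : ∀ {n} → Vec Bool n → Vec Bool n → ℕ
hamming [] [] = 0
hamming (x ∷ xs) (y ∷ ys) with x ≟ᵇ y
... | yes _ = hamming xs ys
... | no  _ = suc (hamming xs ys)

record GoodCode (m n : ℕ) (code : Fin m → Vec Bool n) : Set where
  field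
    distance   : ∀ a b → a ≢ b → n ≤ 3 * hamming (code a) (code b)
    systematic : ∀ a b →
                 (∀ (j : Fin n) → toℕ j < ⌈log₂ m ⌉ → lookup (code a) j ≡ lookup (code b) j) →
                 code a ≡ code b

record IsFixedOrder (m k : ℕ) (ordering : Fin m → Fin (nLen m k) → Subset m) : Set where
  field
    valid      : ∀ a j → ∣ ordering a j ∣ ≡ k ∸ 1 × a ∉ ordering a j
    injective  : ∀ a → Injective _≡_ _≡_ (ordering a)
    surjective : ∀ a (B : Subset m) → ∣ B ∣ ≡ k ∸ 1 → a ∉ B → ∃ λ j → ordering a j ≡ B

lowerSet : ∀ {m} → Fin m → Subset m
lowerSet a = tabulate (λ a' → ⌊ a' ≤? a ⌋)

ord : ∀ {m} → Fin m → Subset m → ℕ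
ord a A = ∣ A ∩ lowerSet a ∣

-- the (1-indexed) t-th bit of a vector; false if out of range
bitAt : ∀ {k} → Vec Bool k → ℕ → Bool
bitAt [] _ = false
bitAt (x ∷ xs) zero = false
bitAt (x ∷ xs) (suc zero) = x
bitAt (x ∷ xs) (suc (suc t)) = bitAt xs (suc t)

-- positions in a sample string: first n bits = the codeword C(a),
-- next n bits = one bit for each B (in the fixed order)
Pos : ℕ → Set
Pos n = Fin n ⊎ Fin n

sampleBit : ∀ {m k} → (Fin m → Vec Bool (nLen m k)) →
            (Fin m → Fin (nLen m k) → Subset m) →
            (Subset m → Vec Bool k) → Fin m → Pos (nLen m k) → Bool
sampleBit code ordering f a (inj₁ j) = lookup (code a) j
sampleBit code ordering f a (inj₂ j) =
  let A = ordering a j ∪ ⁅ a ⁆ in bitAt (f A) (ord a A)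

-- Deterministic algorithms: decision trees whose every node carries a
-- memory set M(u) ⊆ [s]; leaves carry accept/reject; an internal node
-- carries a query (i , position) and a child for each answer bit.

data Tree (s n : ℕ) : Set where
  leaf : (accept : Bool) → (M : Subset s) → Tree s n
  node : (M : Subset s) → (i : Fin s) → (p : Pos n) → (Bool → Tree s n) → Tree s n

memOf : ∀ {s n} → Tree s n → Subset s
memOf (leaf _ M) = M
memOf (node M _ _ _) = M

NeverIn : ∀ {s n} → Fin s → Tree s n → Set
NeverIn i (leaf _ M) = i ∉ M
NeverIn i (node M _ _ ch) = i ∉ M × (∀ b → NeverIn i (ch b))

StrongMemory : ∀ {s n} → ℕ → Tree s n → Set
StrongMemory k' (leaf _ _) = ⊤
StrongMemory k' (node M i p ch) =
  ∣ M ∣ ≤ k' × i ∈ M ×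
  (∀ b j → j ∈ M → j ∉ memOf (ch b) → NeverIn j (ch b)) ×
  (∀ b → StrongMemory k' (ch b))

UsesQueries : ∀ {s n} → ℕ → Tree s n → Set
UsesQueries q (leaf _ _) = ⊤
UsesQueries zero (node _ _ _ _) = ⊥
UsesQueries (suc q) (node _ _ _ ch) = ∀ b → UsesQueries q (ch b)

run : ∀ {s n} → Tree s n → (Fin s → Pos n → Bool) → List (Fin s × Pos n)
run (leaf _ _) x = []
run (node _ i p ch) x = (i , p) ∷ run (ch (x i p)) x

samples : ∀ {m k s} → (Fin m → Vec Bool (nLen m k)) →
          (Fin m → Fin (nLen m k) → Subset m) →
          (Subset m → Vec Bool k) → Vec (Fin m) s → Fin s → Pos (nLen m k) → Bool
samples code ordering f keys i = sampleBit code ordering f (lookup keys i)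

ObtainsBit : ∀ {m k s} → (Fin m → Vec Bool (nLen m k)) →
             (Fin m → Fin (nLen m k) → Subset m) →
             (Subset m → Vec Bool k) → Tree s (nLen m k) → Vec (Fin m) s →
             Subset m → ℕ → Set
ObtainsBit code ordering f T keys A t =
  Σ _ λ i → Σ _ λ j →
    (i , inj₂ j) ∈ₗ run T (samples code ordering f keys) ×
    lookup keys i ∈ A ×
    ordering (lookup keys i) j ≡ A - lookup keys i ×
    t ≡ ord (lookup keys i) A

ObtainsAtMost : ∀ {m k s} → (Fin m → Vec Bool (nLen m k)) →
                (Fin m → Fin (nLen m k) → Subset m) →
                (Subset m → Vec Bool k) → Tree s (nLen m k) → Vec (Fin m) s →
                ℕ → Subset m → Set
ObtainsAtMost code ordering f T keys k' A =
  ¬ (Σ (Fin (suc k') → ℕ) λ g → Injective _≡_ _≡_ g × (∀ l → ObtainsBit code ordering f T keys A (g l)))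

GoodEvent : ∀ {m k s} → (Fin m → Vec Bool (nLen m k)) →
            (Fin m → Fin (nLen m k) → Subset m) →
            (Subset m → Vec Bool k) → ℕ → Tree s (nLen m k) → Vec (Fin m) s → Set
GoodEvent {m} {k} code ordering f k' T keys =
  ∀ (A : Subset m) → ∣ A ∣ ≡ k → ObtainsAtMost code ordering f T keys k' A

{-# OPTIONS --safe #-}
-- Fix one deterministic tree and regard the keys of the s samples as a vector in [m]^s. Call
-- a sample i′ critical at a query (i , B) of the run, where B = A ∖ {key of i}, if i′ has not
-- yet been in memory, its key lies in B and is not covered, and B already contains k' ∸ 1
-- covered keys; a key is covered if a memory sample other than i carries it, or an
-- earlier-indexed sample that has never been in memory does. Until i′ enters memory neither
-- the run, nor B, nor the covered keys depend on the key of i′, so for any fixed values of the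
-- other keys at most q (k ∸ k') values of the key of i′ make it critical somewhere on the run.
-- Summing over the s samples, at most (k ∸ k') s q m^(s-1) key vectors give a critical sample.
--
-- Conversely, let the run obtain k'+1 bits of f(A) through samples with distinct keys in A,
-- and look at the first query revealing one of them, made on a memory sample i. Memory holds
-- at most k' samples, so another witness has not yet been in memory and its key is not held
-- there. Call the first unentered sample carrying a given such key its leader, and let i′ be
-- the last leader: every witness key other than those of i and i′ is then held or carried by
-- an earlier leader, hence covered, and i′ is critical.
module Submission where

open import Defs
open import Data.Bool using (Bool; true; false; _∧_; _∨_; not; if_then_else_; T)
open import Data.Bool.Properties
  using (∧-identityʳ; ∧-zeroʳ; ∨-zeroʳ; ∧-conicalˡ; ∧-conicalʳ; ∨-conicalˡ; ∨-conicalʳ; not-involutive; T-≡)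
open import Data.Empty using (⊥-elim)
open import Data.Fin using (Fin; zero; suc; punchIn; punchOut) renaming (_<_ to _<ᶠ_)
open import Data.Fin.Properties
  using (_≟_; _<?_; <-irrefl; <-cmp; any?; suc-injective; punchIn-punchOut; punchOut-injective)
open import Data.Fin.Subset using (Subset; ∣_∣; _-_)
open import Data.Fin.Subset.Properties using (p─⊥≡p)
open import Data.List using (List; []; _∷_; _++_; map; length)
open import Data.List.Membership.Propositional using (_∈_; _∉_)
open import Data.List.Membership.Propositional.Properties using (∈-++⁺ˡ; ∈-++⁺ʳ; ∈-++⁻; ∈-map⁺; ∈-map⁻)
open import Data.List.Properties using (length-++; length-map)
open import Data.List.Relation.Unary.All using ([])
open import Data.List.Relation.Unary.AllPairs using ([]; _∷_)
open import Data.List.Relation.Unary.Any using (here; there)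
open import Data.List.Relation.Unary.Unique.Propositional using (Unique)
import Data.List.Relation.Unary.Unique.Propositional.Properties as Unique
open import Data.Nat using (ℕ; zero; suc; _+_; _*_; _∸_; _^_; _≤_; z≤n; s≤s; _≤ᵇ_)
open import Data.Nat.Properties hiding (_≟_; _<?_; suc-injective; <-irrefl; <-cmp)
open import Algebra.Properties.CommutativeSemigroup *-commutativeSemigroup using (x∙yz≈y∙xz; x∙yz≈z∙xy)
open import Algebra.Properties.Semiring.Sum +-*-semiring
  using (sum; sum-cong-≗; ∑-distrib-+; ∑-comm; *-distribˡ-sum; sum-remove)
open import Data.Nat.Tactic.RingSolver using (solve-∀)
open import Data.Product using (Σ; _×_; _,_; proj₁; proj₂; ∃)
import Data.Product.Properties as Product
open import Data.Sum using (_⊎_; inj₁; inj₂)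
import Data.Sum.Properties as Sum
open import Data.Unit using (tt)
open import Data.Vec using (Vec; []; _∷_; head; lookup; _[_]≔_; _[_]=_)
open import Data.Vec.Properties using (lookup∘update; lookup∘update′; []=⇒lookup; lookup⇒[]=)
open import Function using (_∘_; case_of_; Equivalence)
open import Function.Definitions using (Injective)
open import Relation.Binary using (tri<; tri≈; tri>)
open import Relation.Binary.PropositionalEquality
open import Relation.Nullary using (¬_; Dec; does; yes; no)
open import Relation.Nullary.Decidable using (dec-true; dec-false)

-- Counting over finite sets

sum-mono : ∀ {n} {f g : Fin n → ℕ} → (∀ i → f i ≤ g i) → sum f ≤ sum g
sum-mono {zero}  f≤g = z≤n
sum-mono {suc n} f≤g = +-mono-≤ (f≤g zero) (sum-mono (f≤g ∘ suc))

sum-const : ∀ n c → sum {n} (λ _ → c) ≡ n * c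
sum-const zero    c = refl
sum-const (suc n) c = cong (c +_) (sum-const n c)

𝟙 : Bool → ℕ
𝟙 b = if b then 1 else 0

count : ∀ {n} → (Fin n → Bool) → ℕ
count P = sum (λ i → 𝟙 (P i))

𝟙-mono : ∀ {a b} → (a ≡ true → b ≡ true) → 𝟙 a ≤ 𝟙 b
𝟙-mono {false} _   = z≤n
𝟙-mono {true}  a⇒b rewrite a⇒b refl = ≤-refl

𝟙-∨ : ∀ a b → 𝟙 (a ∨ b) ≤ 𝟙 a + 𝟙 b
𝟙-∨ true  b = s≤s z≤n
𝟙-∨ false b = ≤-refl

𝟙-split : ∀ a b → 𝟙 a ≡ 𝟙 (a ∧ b) + 𝟙 (a ∧ not b)
𝟙-split true  true  = refl
𝟙-split true  false = refl
𝟙-split false b     = refl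

module _ {n : ℕ} where

  count-cong : {P Q : Fin n → Bool} → (∀ i → P i ≡ Q i) → count P ≡ count Q
  count-cong P≗Q = sum-cong-≗ (cong 𝟙 ∘ P≗Q)

  count-mono : {P Q : Fin n → Bool} → (∀ i → P i ≡ true → Q i ≡ true) → count P ≤ count Q
  count-mono P⇒Q = sum-mono (𝟙-mono ∘ P⇒Q)

  count-true : count {n} (λ _ → true) ≡ n
  count-true = trans (sum-const n 1) (*-identityʳ n)

  count-false : {P : Fin n → Bool} → (∀ i → P i ≡ false) → count P ≡ 0
  count-false {P} P≗false = trans (count-cong P≗false) (trans (sum-const n 0) (*-zeroʳ n))

  count-false≤ : {P : Fin n → Bool} {c : ℕ} → (∀ i → P i ≡ false) → count P ≤ c
  count-false≤ P≗false = ≤-trans (≤-reflexive (count-false P≗false)) z≤n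

  count-∨ : (P Q : Fin n → Bool) → count (λ i → P i ∨ Q i) ≤ count P + count Q
  count-∨ P Q = ≤-trans (sum-mono (λ i → 𝟙-∨ (P i) (Q i)))
                        (≤-reflexive (∑-distrib-+ (𝟙 ∘ P) (𝟙 ∘ Q)))

  count-split : (P Q : Fin n → Bool) →
                count P ≡ count (λ i → P i ∧ Q i) + count (λ i → P i ∧ not (Q i))
  count-split P Q = trans (sum-cong-≗ (λ i → 𝟙-split (P i) (Q i)))
                          (∑-distrib-+ (λ i → 𝟙 (P i ∧ Q i)) (λ i → 𝟙 (P i ∧ not (Q i))))

count-≟ : ∀ {n} (c : Fin n) → count (λ v → does (v ≟ c)) ≡ 1
count-≟ {suc n} zero    = cong suc (count-false {n} (λ _ → refl))
count-≟ {suc n} (suc c) = count-≟ c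

count-∘-injective : ∀ {a b} (P : Fin b → Bool) {h : Fin a → Fin b} →
                    Injective _≡_ _≡_ h → count (P ∘ h) ≤ count P
count-∘-injective {zero}          P h-inj = z≤n
count-∘-injective {suc a} {zero}  P {h} _ with h zero
... | ()
count-∘-injective {suc a} {suc b} P {h} h-inj = begin
  𝟙 (P h₀) + count (P ∘ h ∘ suc)              ≡⟨ cong (𝟙 (P h₀) +_) (count-cong (cong P ∘ sym ∘ punchIn-punchOut ∘ h₀≢)) ⟩
  𝟙 (P h₀) + count (P ∘ punchIn h₀ ∘ h′)       ≤⟨ +-monoʳ-≤ (𝟙 (P h₀)) (count-∘-injective (P ∘ punchIn h₀) h′-inj) ⟩
  𝟙 (P h₀) + count (P ∘ punchIn h₀)            ≡⟨ sum-remove (𝟙 ∘ P) ⟨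
  count P                                      ∎
  where
  open ≤-Reasoning
  h₀ : Fin (suc b)
  h₀ = h zero
  h₀≢ : ∀ j → h₀ ≢ h (suc j)
  h₀≢ j h₀≡ with h-inj h₀≡
  ... | ()
  h′ : Fin a → Fin b
  h′ j = punchOut (h₀≢ j)
  h′-inj : Injective _≡_ _≡_ h′
  h′-inj {i} {j} e = suc-injective (h-inj (punchOut-injective (h₀≢ i) (h₀≢ j) e))

any : ∀ {n} → (Fin n → Bool) → Bool
any {zero}  P = false
any {suc n} P = P zero ∨ any (P ∘ suc)

any-witness : ∀ {n} (P : Fin n → Bool) → any P ≡ true → ∃ λ i → P i ≡ true
any-witness {n = suc n} P e with P zero in P₀
... | true  = zero , P₀
... | false = let i , Pi = any-witness (P ∘ suc) e in suc i , Pi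

any-intro : ∀ {n} (P : Fin n → Bool) (i : Fin n) → P i ≡ true → any P ≡ true
any-intro P zero    Pi rewrite Pi = refl
any-intro P (suc i) Pi = trans (cong (P zero ∨_) (any-intro (P ∘ suc) i Pi)) (∨-zeroʳ (P zero))

any-false : ∀ {n} {P : Fin n → Bool} → (∀ i → P i ≡ false) → any P ≡ false
any-false {n = zero}  _ = refl
any-false {n = suc n} P≗false rewrite P≗false zero = any-false (P≗false ∘ suc)

any-false⁻ : ∀ {n} (P : Fin n → Bool) → any P ≡ false → ∀ i → P i ≡ false
any-false⁻ P e i with P i in Pi
... | false = refl
... | true  with () ← trans (sym (any-intro P i Pi)) e

any-cong : ∀ {n} {P Q : Fin n → Bool} → (∀ i → P i ≡ Q i) → any P ≡ any Q
any-cong {n = zero}  _ = refl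
any-cong {n = suc n} P≗Q = cong₂ _∨_ (P≗Q zero) (any-cong (P≗Q ∘ suc))

𝟙-any≤count : ∀ {n} (P : Fin n → Bool) → 𝟙 (any P) ≤ count P
𝟙-any≤count {n = zero}  P = z≤n
𝟙-any≤count {n = suc n} P =
  ≤-trans (𝟙-∨ (P zero) _) (+-monoʳ-≤ (𝟙 (P zero)) (𝟙-any≤count (P ∘ suc)))

minimal-witness : ∀ {n} (P : Fin n → Bool) c → P c ≡ true →
                  ∃ λ l → P l ≡ true × (∀ l′ → l′ <ᶠ l → P l′ ≡ false)
minimal-witness P zero Pc = zero , Pc , λ _ ()
minimal-witness P (suc c) Pc with P zero in P₀
... | true  = zero , P₀ , λ _ ()
... | false with l , Pl , below ← minimal-witness (P ∘ suc) c Pc =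
  suc l , Pl , λ { zero _ → P₀ ; (suc l′) (s≤s l′<l) → below l′ l′<l }

maximal-witness : ∀ {n} (P : Fin n → Bool) c → P c ≡ true →
                  ∃ λ l → P l ≡ true × (∀ l′ → l <ᶠ l′ → P l′ ≡ false)
maximal-witness {suc n} P c Pc with any (P ∘ suc) in later
... | true with c′ , Pc′ ← any-witness (P ∘ suc) later
           with l , Pl , above ← maximal-witness (P ∘ suc) c′ Pc′ =
  suc l , Pl , λ { (suc l′) (s≤s l<l′) → above l′ l<l′ }
maximal-witness {suc n} P zero    Pc | false = zero , Pc , λ { (suc l′) _ → any-false⁻ (P ∘ suc) later l′ }
maximal-witness {suc n} P (suc c) Pc | false with () ← trans (sym (any-intro (P ∘ suc) c Pc)) later

concatOver : ∀ {n} {A : Set} → (Fin n → List A) → List A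
concatOver {zero}  g = []
concatOver {suc n} g = g zero ++ concatOver (g ∘ suc)

module _ {A : Set} where

  length-concatOver : ∀ {n} (g : Fin n → List A) → length (concatOver g) ≡ sum (length ∘ g)
  length-concatOver {zero}  g = refl
  length-concatOver {suc n} g =
    trans (length-++ (g zero)) (cong (length (g zero) +_) (length-concatOver (g ∘ suc)))

  ∈-concatOver⁺ : ∀ {n} (g : Fin n → List A) {x} i → x ∈ g i → x ∈ concatOver g
  ∈-concatOver⁺ g zero    x∈ = ∈-++⁺ˡ x∈
  ∈-concatOver⁺ g (suc i) x∈ = ∈-++⁺ʳ (g zero) (∈-concatOver⁺ (g ∘ suc) i x∈)

  ∈-concatOver⁻ : ∀ {n} (g : Fin n → List A) {x} → x ∈ concatOver g → ∃ λ i → x ∈ g i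
  ∈-concatOver⁻ {suc n} g x∈ with ∈-++⁻ (g zero) x∈
  ... | inj₁ x∈g₀ = zero , x∈g₀
  ... | inj₂ x∈gs = let i , x∈gᵢ = ∈-concatOver⁻ (g ∘ suc) x∈gs in suc i , x∈gᵢ

  concatOver-unique : ∀ {n} (g : Fin n → List A) →
                      (∀ {i j x} → x ∈ g i → x ∈ g j → i ≡ j) → (∀ i → Unique (g i)) →
                      Unique (concatOver g)
  concatOver-unique {zero}  g separate unique = []
  concatOver-unique {suc n} g separate unique =
    Unique.++⁺ (unique zero)
               (concatOver-unique (g ∘ suc) (λ x∈i x∈j → suc-injective (separate x∈i x∈j)) (unique ∘ suc))
               disjoint
    where
    disjoint : ∀ {x} → ¬ (x ∈ g zero × x ∈ concatOver (g ∘ suc))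
    disjoint (x∈g₀ , x∈gs) with i , x∈gᵢ ← ∈-concatOver⁻ (g ∘ suc) x∈gs
      with () ← separate x∈g₀ x∈gᵢ

-- Vectors of keys

module _ {m : ℕ} where

  sumV : ∀ s → (Vec (Fin m) s → ℕ) → ℕ
  sumV zero    h = h []
  sumV (suc s) h = sum (λ w → sumV s (h ∘ (w ∷_)))

  countV : ∀ s → (Vec (Fin m) s → Bool) → ℕ
  countV s P = sumV s (𝟙 ∘ P)

  sumV-mono : ∀ s {h g : Vec (Fin m) s → ℕ} → (∀ x → h x ≤ g x) → sumV s h ≤ sumV s g
  sumV-mono zero    h≤g = h≤g []
  sumV-mono (suc s) h≤g = sum-mono (λ w → sumV-mono s (h≤g ∘ (w ∷_)))

  sumV-const : ∀ s c → sumV s (λ _ → c) ≡ m ^ s * c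
  sumV-const zero    c = sym (+-identityʳ c)
  sumV-const (suc s) c = begin
    sum {m} (λ _ → sumV s (λ _ → c)) ≡⟨ sum-cong-≗ {m} (λ _ → sumV-const s c) ⟩
    sum {m} (λ _ → m ^ s * c)        ≡⟨ sum-const m (m ^ s * c) ⟩
    m * (m ^ s * c)              ≡⟨ *-assoc m (m ^ s) c ⟨
    m * m ^ s * c                ∎
    where open ≡-Reasoning

  sumV-comm : ∀ {n} s (h : Fin n → Vec (Fin m) s → ℕ) →
              sumV s (λ x → sum (λ j → h j x)) ≡ sum (λ j → sumV s (h j))
  sumV-comm zero    h = refl
  sumV-comm (suc s) h = trans (sum-cong-≗ {m} (λ w → sumV-comm s (λ j → h j ∘ (w ∷_))))
                              (∑-comm (λ w j → sumV s (h j ∘ (w ∷_))))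

  countV-any≤ : ∀ s {n} (P : Fin n → Vec (Fin m) s → Bool) →
                countV s (λ x → any (λ j → P j x)) ≤ sum (λ j → countV s (P j))
  countV-any≤ s P = ≤-trans (sumV-mono s (λ x → 𝟙-any≤count (λ j → P j x)))
                            (≤-reflexive (sumV-comm s (λ j → 𝟙 ∘ P j)))

  count-by-coordinate : ∀ s (i : Fin s) (P : Vec (Fin m) s → Bool) c →
                        (∀ y → count (λ v → P (y [ i ]≔ v)) ≤ c) → m * countV s P ≤ c * m ^ s
  count-by-coordinate (suc s) zero P c bound = begin
    m * sum (λ w → countV s (P ∘ (w ∷_)))                     ≡⟨ cong (m *_) (sumV-comm s (λ w → 𝟙 ∘ P ∘ (w ∷_))) ⟨
    m * sumV s (λ y → count (λ v → P (v ∷ y)))               ≡⟨ sum-const m _ ⟨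
    sum (λ (_ : Fin m) → sumV s (λ y → count (λ v → P (v ∷ y)))) ≤⟨ sum-mono (λ w → sumV-mono s (bound ∘ (w ∷_))) ⟩
    sum (λ (_ : Fin m) → sumV s (λ _ → c))                    ≡⟨ sum-cong-≗ {m} (λ _ → sumV-const s c) ⟩
    sum (λ (_ : Fin m) → m ^ s * c)                           ≡⟨ sum-const m (m ^ s * c) ⟩
    m * (m ^ s * c)                                           ≡⟨ x∙yz≈z∙xy m (m ^ s) c ⟩
    c * (m * m ^ s)                                           ∎
    where open ≤-Reasoning
  count-by-coordinate (suc s) (suc i) P c bound = begin
    m * sum (λ w → countV s (P ∘ (w ∷_)))          ≡⟨ *-distribˡ-sum m (λ w → countV s (P ∘ (w ∷_))) ⟩
    sum (λ w → m * countV s (P ∘ (w ∷_)))          ≤⟨ sum-mono (λ w → count-by-coordinate s i (P ∘ (w ∷_)) c (bound ∘ (w ∷_))) ⟩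
    sum {m} (λ _ → c * m ^ s)                      ≡⟨ sum-const m (c * m ^ s) ⟩
    m * (c * m ^ s)                                ≡⟨ x∙yz≈y∙xz m c (m ^ s) ⟩
    c * (m * m ^ s)                                ∎
    where open ≤-Reasoning

  enumerate : ∀ s → (Vec (Fin m) s → Bool) → List (Vec (Fin m) s)
  enumerate zero    P = if P [] then [] ∷ [] else []
  enumerate (suc s) P = concatOver (λ w → map (w ∷_) (enumerate s (P ∘ (w ∷_))))

  length-enumerate : ∀ s P → length (enumerate s P) ≡ countV s P
  length-enumerate zero P with P []
  ... | true  = refl
  ... | false = refl
  length-enumerate (suc s) P = trans (length-concatOver {n = m} _) (sum-cong-≗ {m} λ w →
    trans (length-map (w ∷_) (enumerate s _)) (length-enumerate s (P ∘ (w ∷_))))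

  ∈-enumerate : ∀ s P x → P x ≡ true → x ∈ enumerate s P
  ∈-enumerate zero    P [] Px rewrite Px = here refl
  ∈-enumerate (suc s) P (w ∷ y) Px =
    ∈-concatOver⁺ _ w (∈-map⁺ (w ∷_) (∈-enumerate s (P ∘ (w ∷_)) y Px))

  enumerate-unique : ∀ s P → Unique (enumerate s P)
  enumerate-unique zero P with P []
  ... | true  = [] ∷ []
  ... | false = []
  enumerate-unique (suc s) P = concatOver-unique _ separate
    (λ w → Unique.map⁺ (λ { refl → refl }) (enumerate-unique s (P ∘ (w ∷_))))
    where
    head-of : ∀ {w xs x} → x ∈ map (w ∷_) xs → head x ≡ w
    head-of x∈ with _ , _ , refl ← ∈-map⁻ _ x∈ = refl
    separate : ∀ {v w x} → x ∈ map (v ∷_) _ → x ∈ map (w ∷_) _ → v ≡ w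
    separate x∈v x∈w = trans (sym (head-of x∈v)) (head-of x∈w)

  enumeratePairs : ∀ {r} s → (Fin r → Vec (Fin m) s → Bool) → List (Fin r × Vec (Fin m) s)
  enumeratePairs s P = concatOver (λ ι → map (ι ,_) (enumerate s (P ι)))

  enumeratePairs-unique : ∀ {r} s P → Unique (enumeratePairs {r} s P)
  enumeratePairs-unique s P = concatOver-unique _ (λ p∈ q∈ → trans (sym (tag p∈)) (tag q∈))
    (λ ι → Unique.map⁺ (cong proj₂) (enumerate-unique s (P ι)))
    where
    tag : ∀ {ι xs p} → p ∈ map (ι ,_) xs → proj₁ p ≡ ι
    tag p∈ with _ , _ , refl ← ∈-map⁻ _ p∈ = refl

  ∈-enumeratePairs : ∀ {r} s P ι x → P ι x ≡ true → (ι , x) ∈ enumeratePairs {r} s P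
  ∈-enumeratePairs s P ι x Pιx = ∈-concatOver⁺ _ ι (∈-map⁺ _ (∈-enumerate s (P ι) x Pιx))

  m*length-enumeratePairs≤ : ∀ {r} s P c → (∀ ι → m * countV s (P ι) ≤ c * m ^ s) →
                             m * length (enumeratePairs {r} s P) ≤ c * (r * m ^ s)
  m*length-enumeratePairs≤ {r} s P c bound = begin
    m * length (enumeratePairs s P)   ≡⟨ cong (m *_) length-pairs ⟩
    m * sum (λ ι → countV s (P ι))    ≡⟨ *-distribˡ-sum {r} m _ ⟩
    sum (λ ι → m * countV s (P ι))    ≤⟨ sum-mono bound ⟩
    sum {r} (λ _ → c * m ^ s)         ≡⟨ sum-const r _ ⟩
    r * (c * m ^ s)                   ≡⟨ x∙yz≈y∙xz r c (m ^ s) ⟩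
    c * (r * m ^ s)                   ∎
    where
    open ≤-Reasoning
    length-pairs : length (enumeratePairs s P) ≡ sum (λ ι → countV s (P ι))
    length-pairs = trans (length-concatOver {n = r} _) (sum-cong-≗ {r} λ ι →
                     trans (length-map (ι ,_) (enumerate s (P ι))) (length-enumerate s (P ι)))

from-does : ∀ {P : Set} (d : Dec P) → does d ≡ true → P
from-does (yes p) _ = p

not≡true⇒false : ∀ {b} → not b ≡ true → b ≡ false
not≡true⇒false {false} _ = refl

∨-introʳ : ∀ a {b} → b ≡ true → a ∨ b ≡ true
∨-introʳ a b≡true = trans (cong (a ∨_) b≡true) (∨-zeroʳ a)

∣p∣≡count : ∀ {n} (p : Subset n) → ∣ p ∣ ≡ count (lookup p)
∣p∣≡count []          = refl
∣p∣≡count (true ∷ p)  = cong suc (∣p∣≡count p)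
∣p∣≡count (false ∷ p) = ∣p∣≡count p

lookup-minus : ∀ {n} (p : Subset n) a v → lookup (p - a) v ≡ lookup p v ∧ not (does (v ≟ a))
lookup-minus (b ∷ p) zero    zero    = sym (∧-zeroʳ b)
lookup-minus (b ∷ p) zero    (suc v) = trans (cong (λ q → lookup q v) (p─⊥≡p p)) (sym (∧-identityʳ _))
lookup-minus (b ∷ p) (suc a) zero    = sym (∧-identityʳ b)
lookup-minus (b ∷ p) (suc a) (suc v) = lookup-minus p a v

rest≤k∸k' : ∀ {k k' total inside rest} → total ≡ inside + rest → total ≡ k ∸ 1 →
            k' ∸ 1 ≤ inside → rest ≤ k ∸ k'
rest≤k∸k' {k} {k'} {total} {inside} {rest} split total≡ enough = begin
  rest                  ≡⟨ m+n∸m≡n inside rest ⟨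
  inside + rest ∸ inside ≡⟨ cong (_∸ inside) (trans (sym split) total≡) ⟩
  k ∸ 1 ∸ inside        ≤⟨ ∸-monoʳ-≤ (k ∸ 1) enough ⟩
  k ∸ 1 ∸ (k' ∸ 1)      ≤⟨ drop-one k' ⟩
  k ∸ k'                ∎
  where
  open ≤-Reasoning
  drop-one : ∀ k' → k ∸ 1 ∸ (k' ∸ 1) ≤ k ∸ k'
  drop-one zero     = m∸n≤m k 1
  drop-one (suc k') = ≤-reflexive (∸-+-assoc k 1 k')

-- Critical samples

module CriticalSamples {m s n : ℕ} (k k' : ℕ)
  (ordering : Fin m → Fin n → Subset m) (answer : Fin m → Pos n → Bool) where

  Keys : Set
  Keys = Vec (Fin m) s

  samplesWith : Keys → Fin s → Pos n → Bool
  samplesWith x i = answer (lookup x i)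

  entering : (Fin s → Bool) → Subset s → Fin s → Bool
  entering E M l = E l ∨ lookup M l

  -- M is the memory at a node querying sample i, and E marks the samples that have been in memory.
  covering : Subset s → Fin s → (Fin s → Bool) → Fin s → Fin s → Bool
  covering M i E i′ l = (lookup M l ∧ not (does (l ≟ i))) ∨ (not (E l) ∧ does (l <? i′))

  coveredKeys : Subset s → Fin s → (Fin s → Bool) → Fin s → Keys → Fin m → Bool
  coveredKeys M i E i′ x v = any λ l → covering M i E i′ l ∧ does (lookup x l ≟ v)

  critical : Subset s → Fin s → Pos n → (Fin s → Bool) → Fin s → Keys → Bool
  critical M i (inj₁ _) E i′ x = false
  critical M i (inj₂ j) E i′ x =
    lookup (ordering (lookup x i) j) (lookup x i′) ∧
    (not (coveredKeys M i E i′ x (lookup x i′)) ∧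
     (k' ∸ 1 ≤ᵇ count (λ v → lookup (ordering (lookup x i) j) v ∧ coveredKeys M i E i′ x v)))

  criticalOnRun : Tree s n → (Fin s → Bool) → Fin s → Keys → Bool
  criticalOnRun (leaf _ _)        E i′ x = false
  criticalOnRun (node M i p next) E i′ x =
    (not (entering E M i′) ∧ critical M i p (entering E M) i′ x) ∨
    criticalOnRun (next (samplesWith x i p)) (entering E M) i′ x

  criticalOnRun-entered : ∀ T E i′ x → E i′ ≡ true → criticalOnRun T E i′ x ≡ false
  criticalOnRun-entered (leaf _ _)        E i′ x Ei′ = refl
  criticalOnRun-entered (node M i p next) E i′ x Ei′ rewrite Ei′ =
    criticalOnRun-entered (next (samplesWith x i p)) (entering E M) i′ x (cong (_∨ lookup M i′) Ei′)

  covering-self : ∀ M i E i′ → E i′ ≡ false → lookup M i′ ≡ false → covering M i E i′ i′ ≡ false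
  covering-self M i E i′ Ei′ Mi′ =
    cong₂ _∨_ (cong (_∧ _) Mi′) (cong₂ _∧_ (cong not Ei′) (dec-false (i′ <? i′) (<-irrefl refl)))

  coveredKeys-update : ∀ M i E i′ y v u → E i′ ≡ false → lookup M i′ ≡ false →
                       coveredKeys M i E i′ (y [ i′ ]≔ v) u ≡ coveredKeys M i E i′ y u
  coveredKeys-update M i E i′ y v u Ei′ Mi′ = any-cong same
    where
    same : ∀ l → covering M i E i′ l ∧ does (lookup (y [ i′ ]≔ v) l ≟ u)
               ≡ covering M i E i′ l ∧ does (lookup y l ≟ u)
    same l with l ≟ i′
    ... | yes refl = trans (cong (_∧ _) (covering-self M i E l Ei′ Mi′))
                           (sym (cong (_∧ _) (covering-self M i E l Ei′ Mi′)))
    ... | no l≢i′ rewrite lookup∘update′ l≢i′ y v = refl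

  count-critical : (∀ a j → ∣ ordering a j ∣ ≡ k ∸ 1) →
                   ∀ M i p E i′ y → E i′ ≡ false → lookup M i′ ≡ false → i ≢ i′ →
                   count (λ v → critical M i p E i′ (y [ i′ ]≔ v)) ≤ k ∸ k'
  count-critical card M i (inj₁ _) E i′ y Ei′ Mi′ i≢i′ = count-false≤ {m} (λ _ → refl)
  count-critical card M i (inj₂ j) E i′ y Ei′ Mi′ i≢i′ =
    ≤-trans (≤-reflexive (count-cong unfold)) (bound enough refl)
    where
    B K : Fin m → Bool
    B = lookup (ordering (lookup y i) j)
    K = coveredKeys M i E i′ y
    enough : Bool
    enough = k' ∸ 1 ≤ᵇ count (λ v → B v ∧ K v)
    unfold : ∀ v → critical M i (inj₂ j) E i′ (y [ i′ ]≔ v) ≡ B v ∧ (not (K v) ∧ enough)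
    unfold v rewrite lookup∘update′ i≢i′ y v | lookup∘update i′ y v
                   | coveredKeys-update M i E i′ y v v Ei′ Mi′
                   | count-cong (λ u → cong (B u ∧_) (coveredKeys-update M i E i′ y v u Ei′ Mi′)) = refl
    B-size : count B ≡ k ∸ 1
    B-size = trans (sym (∣p∣≡count (ordering (lookup y i) j))) (card (lookup y i) j)
    bound : ∀ b → enough ≡ b → count (λ v → B v ∧ (not (K v) ∧ b)) ≤ k ∸ k'
    bound false _ = count-false≤ {m} (λ v → trans (cong (B v ∧_) (∧-zeroʳ _)) (∧-zeroʳ _))
    bound true  e = ≤-trans (≤-reflexive (count-cong (λ v → cong (B v ∧_) (∧-identityʳ _))))
      (rest≤k∸k' {k} {k'} (count-split B K) B-size (≤ᵇ⇒≤ (k' ∸ 1) _ (subst T (sym e) tt)))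

  count-criticalOnRun : (∀ a j → ∣ ordering a j ∣ ≡ k ∸ 1) →
    ∀ q T → UsesQueries q T → StrongMemory k' T → ∀ E i′ y →
    count (λ v → criticalOnRun T E i′ (y [ i′ ]≔ v)) ≤ q * (k ∸ k')
  count-criticalOnRun card q (leaf _ _) _ _ E i′ y = count-false≤ {m} (λ _ → refl)
  count-criticalOnRun card (suc q) (node M i p next) uses (_ , i∈M , _ , memory) E i′ y
    with entering E M i′ in entered
  ... | true = count-false≤ {m} λ v →
        criticalOnRun-entered (next _) (entering E M) i′ (y [ i′ ]≔ v) entered
  ... | false = begin
    count (λ v → atNode v ∨ later (samplesWith (y [ i′ ]≔ v) i p) v)
      ≡⟨ count-cong (λ v → cong (λ b → atNode v ∨ later b v) (cong (λ a → answer a p) (lookup∘update′ i≢i′ y v))) ⟩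
    count (λ v → atNode v ∨ later (samplesWith y i p) v)
      ≤⟨ count-∨ atNode (later (samplesWith y i p)) ⟩
    count atNode + count (later (samplesWith y i p))
      ≤⟨ +-mono-≤ (count-critical card M i p E′ i′ y entered Mi′ i≢i′)
                  (count-criticalOnRun card q (next _) (uses _) (memory _) E′ i′ y) ⟩
    suc q * (k ∸ k') ∎
    where
    open ≤-Reasoning
    E′ : Fin s → Bool
    E′ = entering E M
    atNode : Fin m → Bool
    atNode v = critical M i p E′ i′ (y [ i′ ]≔ v)
    later : Bool → Fin m → Bool
    later b v = criticalOnRun (next b) E′ i′ (y [ i′ ]≔ v)
    Mi′ : lookup M i′ ≡ false
    Mi′ = ∨-conicalʳ (E i′) _ entered
    i≢i′ : i ≢ i′
    i≢i′ refl with () ← trans (sym ([]=⇒lookup i∈M)) Mi′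

  criticalSomewhere : Tree s n → Keys → Bool
  criticalSomewhere T x = any (λ i′ → criticalOnRun T (λ _ → false) i′ x)

  count-criticalSomewhere : (∀ a j → ∣ ordering a j ∣ ≡ k ∸ 1) →
    ∀ q T → UsesQueries q T → StrongMemory k' T →
    m * countV s (criticalSomewhere T) ≤ (k ∸ k') * s * q * m ^ s
  count-criticalSomewhere card q T uses memory = begin
    m * countV s (criticalSomewhere T)
      ≤⟨ *-monoʳ-≤ m (countV-any≤ s (criticalOnRun T (λ _ → false))) ⟩
    m * sum (λ i′ → countV s (criticalOnRun T (λ _ → false) i′))
      ≡⟨ *-distribˡ-sum {s} m _ ⟩
    sum (λ i′ → m * countV s (criticalOnRun T (λ _ → false) i′))
      ≤⟨ sum-mono (λ i′ → count-by-coordinate s i′ _ (q * (k ∸ k'))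
                           (count-criticalOnRun card q T uses memory (λ _ → false) i′)) ⟩
    sum {s} (λ _ → q * (k ∸ k') * m ^ s)
      ≡⟨ sum-const s _ ⟩
    s * (q * (k ∸ k') * m ^ s)
      ≡⟨ reorder s q (k ∸ k') (m ^ s) ⟩
    (k ∸ k') * s * q * m ^ s ∎
    where
    open ≤-Reasoning
    reorder : ∀ s q d M → s * (q * d * M) ≡ d * s * q * M
    reorder = solve-∀

  module ObtainedBits (x : Keys) (A : Subset m)
    (wit : Fin (suc k') → Fin s) (pos : Fin (suc k') → Fin n)
    (key∈A : ∀ l → lookup A (lookup x (wit l)) ≡ true)
    (pos-spec : ∀ l → ordering (lookup x (wit l)) (pos l) ≡ A - lookup x (wit l))
    (distinct : Injective _≡_ _≡_ (lookup x ∘ wit)) where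

    key : Fin s → Fin m
    key = lookup x

    module AtQuery (M : Subset s) (E : Fin s → Bool) (l₀ : Fin (suc k'))
      (|M|≤k' : ∣ M ∣ ≤ k')
      (M⊆E : ∀ t → lookup M t ≡ true → E t ≡ true)
      (l₀∈M : lookup M (wit l₀) ≡ true)
      (unentered-or-held : ∀ l → E (wit l) ≡ false ⊎ lookup M (wit l) ≡ true) where

      i : Fin s
      i = wit l₀

      B : Fin m → Bool
      B = lookup (ordering (key i) (pos l₀))

      B-key : ∀ l → l ≢ l₀ → B (key (wit l)) ≡ true
      B-key l l≢l₀ = begin
        B (key (wit l))                                         ≡⟨ cong (λ S → lookup S (key (wit l))) (pos-spec l₀) ⟩
        lookup (A - key i) (key (wit l))                        ≡⟨ lookup-minus A (key i) (key (wit l)) ⟩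
        lookup A (key (wit l)) ∧ not (does (key (wit l) ≟ key i)) ≡⟨ cong₂ _∧_ (key∈A l) (cong not (dec-false (_ ≟ _) (l≢l₀ ∘ distinct))) ⟩
        true                                                    ∎
        where open ≡-Reasoning

      held : Fin m → Bool
      held v = any (λ t → (lookup M t ∧ not (does (t ≟ i))) ∧ does (key t ≟ v))

      fresh : Fin (suc k') → Bool
      fresh l = not (E (wit l)) ∧ not (held (key (wit l)))

      holder : (∀ l → fresh l ≡ false) → ∀ l → ∃ λ t → lookup M t ≡ true × key t ≡ key (wit l)
      holder none l with lookup M (wit l) in wit-l∈M
      ... | true  = wit l , wit-l∈M , refl
      ... | false with unentered-or-held l
      ... | inj₂ wit-l∈M′ with () ← trans (sym wit-l∈M′) wit-l∈M
      ... | inj₁ unentered with held (key (wit l)) in is-held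
      ... | false with () ← trans (sym (cong₂ _∧_ (cong not unentered) (cong not is-held))) (none l)
      ... | true with t , holds ← any-witness _ is-held =
        t , ∧-conicalˡ _ _ (∧-conicalˡ _ _ holds) , from-does (_ ≟ _) (∧-conicalʳ _ _ holds)

      no-fresh⇒overflow : (∀ l → fresh l ≡ false) → suc k' ≤ k'
      no-fresh⇒overflow none = begin
        suc k'                                   ≡⟨ count-true ⟨
        count (λ (_ : Fin (suc k')) → true)      ≡⟨ count-cong (proj₁ ∘ proj₂ ∘ holder none) ⟨
        count (lookup M ∘ proj₁ ∘ holder none)   ≤⟨ count-∘-injective (lookup M) holder-injective ⟩
        count (lookup M)                         ≡⟨ ∣p∣≡count M ⟨
        ∣ M ∣                                    ≤⟨ |M|≤k' ⟩
        k'                                       ∎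
        where
        open ≤-Reasoning
        holder-injective : Injective _≡_ _≡_ (proj₁ ∘ holder none)
        holder-injective {l} {l′} same = distinct
          (trans (sym (proj₂ (proj₂ (holder none l))))
                 (trans (cong key same) (proj₂ (proj₂ (holder none l′)))))

      some-fresh : ∃ λ l → fresh l ≡ true
      some-fresh with any fresh in e
      ... | true  = any-witness fresh e
      ... | false with () ← 1+n≰n (no-fresh⇒overflow (any-false⁻ fresh e))

      candidate : Fin s → Bool
      candidate t = not (E t) ∧ (B (key t) ∧ not (held (key t)))

      fresh⇒candidate : ∀ l → fresh l ≡ true → candidate (wit l) ≡ true
      fresh⇒candidate l fresh-l =
        cong₂ _∧_ unentered (cong₂ _∧_ (B-key l l≢l₀) (∧-conicalʳ (not (E (wit l))) _ fresh-l))
        where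
        unentered : not (E (wit l)) ≡ true
        unentered = ∧-conicalˡ _ _ fresh-l
        l≢l₀ : l ≢ l₀
        l≢l₀ refl with () ← trans (sym unentered) (cong not (M⊆E i l₀∈M))

      leader : Fin s → Bool
      leader t = candidate t ∧ not (any (λ t′ → does (t′ <? t) ∧ (candidate t′ ∧ does (key t′ ≟ key t))))

      leader-of : ∀ t → candidate t ≡ true → ∃ λ r → leader r ≡ true × key r ≡ key t
      leader-of t candidate-t
        with r , same-key , earliest ← minimal-witness (λ u → candidate u ∧ does (key u ≟ key t)) t
                                        (cong₂ _∧_ candidate-t (dec-true (key t ≟ key t) refl))
        = r , cong₂ _∧_ (∧-conicalˡ _ _ same-key) (cong not (any-false none-earlier)) , key-r
        where
        key-r : key r ≡ key t
        key-r = from-does (_ ≟ _) (∧-conicalʳ _ _ same-key)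
        none-earlier : ∀ t′ → does (t′ <? r) ∧ (candidate t′ ∧ does (key t′ ≟ key r)) ≡ false
        none-earlier t′ with t′ <? r
        ... | no  t′≮r rewrite dec-false (t′ <? r) t′≮r = refl
        ... | yes t′<r rewrite dec-true (t′ <? r) t′<r | key-r = earliest t′ t′<r

      last-leader : ∃ λ i′ → leader i′ ≡ true × (∀ t → i′ <ᶠ t → leader t ≡ false)
      last-leader with l₁ , fresh-l₁ ← some-fresh
                  with r , leader-r , _ ← leader-of (wit l₁) (fresh⇒candidate l₁ fresh-l₁)
        = maximal-witness leader r leader-r

      module LastLeader (i′ : Fin s) (leader-i′ : leader i′ ≡ true)
                        (after-i′ : ∀ t → i′ <ᶠ t → leader t ≡ false) where

        K : Fin m → Bool
        K = coveredKeys M i E i′ x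

        candidate-i′ : candidate i′ ≡ true
        candidate-i′ = ∧-conicalˡ (candidate i′) _ leader-i′

        unentered-i′ : E i′ ≡ false
        unentered-i′ = not≡true⇒false (∧-conicalˡ (not (E i′)) _ candidate-i′)

        B-i′ : B (key i′) ≡ true
        B-i′ = ∧-conicalˡ (B (key i′)) _ (∧-conicalʳ (not (E i′)) _ candidate-i′)

        unheld-i′ : held (key i′) ≡ false
        unheld-i′ = not≡true⇒false (∧-conicalʳ (B (key i′)) _ (∧-conicalʳ (not (E i′)) _ candidate-i′))

        candidate-like-i′ : ∀ t → not (E t) ≡ true → key t ≡ key i′ → candidate t ≡ true
        candidate-like-i′ t unentered same = cong₂ _∧_ unentered
          (subst (λ v → B v ∧ not (held v) ≡ true) (sym same) (∧-conicalʳ (not (E i′)) _ candidate-i′))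

        unheld-like-i′ : ∀ t → key t ≡ key i′ → lookup M t ∧ not (does (t ≟ i)) ≡ false
        unheld-like-i′ t same with lookup M t ∧ not (does (t ≟ i)) in held-t
        ... | false = refl
        ... | true with () ← trans (sym (any-intro _ t (cong₂ _∧_ held-t (dec-true (key t ≟ key i′) same))))
                                   unheld-i′

        no-earlier-like-i′ : ∀ t → key t ≡ key i′ → not (E t) ∧ does (t <? i′) ≡ false
        no-earlier-like-i′ t same with not (E t) ∧ does (t <? i′) in earlier-t
        ... | false = refl
        ... | true with () ← trans (sym (any-intro _ t (cong₂ _∧_ (∧-conicalʳ (not (E t)) _ earlier-t)
                                 (cong₂ _∧_ (candidate-like-i′ t (∧-conicalˡ (not (E t)) _ earlier-t) same)
                                            (dec-true (key t ≟ key i′) same)))))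
                               (not≡true⇒false (∧-conicalʳ (candidate i′) _ leader-i′))

        uncovered-i′ : K (key i′) ≡ false
        uncovered-i′ = any-false not-covering
          where
          not-covering : ∀ t → covering M i E i′ t ∧ does (key t ≟ key i′) ≡ false
          not-covering t with key t ≟ key i′
          ... | no  _    = ∧-zeroʳ _
          ... | yes same = cong (_∧ true) (cong₂ _∨_ (unheld-like-i′ t same) (no-earlier-like-i′ t same))

        covered-witness : ∀ l → l ≢ l₀ → key (wit l) ≢ key i′ → K (key (wit l)) ≡ true
        covered-witness l l≢l₀ key≢ with held (key (wit l)) in held-l
        ... | true with t , holds ← any-witness _ held-l =
          any-intro _ t (cong₂ _∧_ (cong (_∨ _) (∧-conicalˡ (lookup M t ∧ not (does (t ≟ i))) _ holds))
                                    (∧-conicalʳ (lookup M t ∧ not (does (t ≟ i))) _ holds))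
        ... | false with unentered-or-held l
        ...   | inj₂ wit-l∈M with () ← trans (sym (any-intro _ (wit l)
                  (cong₂ _∧_ (cong₂ _∧_ wit-l∈M (cong not (dec-false (wit l ≟ i) (l≢l₀ ∘ distinct ∘ cong key))))
                             (dec-true (key (wit l) ≟ key (wit l)) refl)))) held-l
        ...   | inj₁ unentered
                with r , leader-r , key-r ← leader-of (wit l) (cong₂ _∧_ (cong not unentered)
                                                                (cong₂ _∧_ (B-key l l≢l₀) (cong not held-l)))
                with <-cmp r i′
        ...     | tri≈ _ r≡i′ _ = ⊥-elim (key≢ (trans (sym key-r) (cong key r≡i′)))
        ...     | tri> _ _ i′<r with () ← trans (sym leader-r) (after-i′ r i′<r)
        ...     | tri< r<i′ _ _ = any-intro _ r (cong₂ _∧_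
                    (∨-introʳ _ (cong₂ _∧_ (∧-conicalˡ (not (E r)) _ (∧-conicalˡ (candidate r) _ leader-r))
                                           (dec-true (r <? i′) r<i′)))
                    (dec-true (key r ≟ key (wit l)) key-r))

        enough-covered : k' ∸ 1 ≤ count (λ v → B v ∧ K v)
        enough-covered = begin
          k' ∸ 1                                  ≤⟨ k'∸1≤ (count-split (λ _ → true) other) count-excluded ⟩
          count other                             ≤⟨ count-mono other-covered ⟩
          count ((λ v → B v ∧ K v) ∘ key ∘ wit)   ≤⟨ count-∘-injective (λ v → B v ∧ K v) distinct ⟩
          count (λ v → B v ∧ K v)                 ∎
          where
          open ≤-Reasoning
          excluded : Fin (suc k') → Bool
          excluded l = does (l ≟ l₀) ∨ does (key (wit l) ≟ key i′)
          other : Fin (suc k') → Bool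
          other l = not (excluded l)
          other-covered : ∀ l → other l ≡ true → B (key (wit l)) ∧ K (key (wit l)) ≡ true
          other-covered l other-l = cong₂ _∧_ (B-key l l≢l₀) (covered-witness l l≢l₀ key≢)
            where
            l≢l₀ : l ≢ l₀
            l≢l₀ refl with () ← trans (sym (dec-true (l ≟ l) refl)) (∨-conicalˡ _ _ (not≡true⇒false other-l))
            key≢ : key (wit l) ≢ key i′
            key≢ same with () ← trans (sym (dec-true (key (wit l) ≟ key i′) same))
                                      (∨-conicalʳ (does (l ≟ l₀)) _ (not≡true⇒false other-l))
          count-excluded : count (λ l → not (other l)) ≤ 2
          count-excluded = begin
            count (λ l → not (other l))              ≡⟨ count-cong (λ l → not-involutive (excluded l)) ⟩
            count excluded                           ≤⟨ count-∨ (λ l → does (l ≟ l₀)) (λ l → does (key (wit l) ≟ key i′)) ⟩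
            count (λ l → does (l ≟ l₀)) + count (λ l → does (key (wit l) ≟ key i′))
              ≤⟨ +-mono-≤ (≤-reflexive (count-≟ l₀))
                          (≤-trans (count-∘-injective (λ v → does (v ≟ key i′)) distinct) (≤-reflexive (count-≟ (key i′)))) ⟩
            2                                        ∎
          k'∸1≤ : ∀ {g c} → count {suc k'} (λ _ → true) ≡ g + c → c ≤ 2 → k' ∸ 1 ≤ g
          k'∸1≤ {g} {c} split c≤2 = begin
            suc k' ∸ 2 ≤⟨ ∸-monoʳ-≤ (suc k') c≤2 ⟩
            suc k' ∸ c ≡⟨ cong (_∸ c) (trans (sym count-true) split) ⟩
            g + c ∸ c  ≡⟨ m+n∸n≡m g c ⟩
            g          ∎

        critical-i′ : (not (E i′) ∧ critical M i (inj₂ (pos l₀)) E i′ x) ≡ true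
        critical-i′ = cong₂ _∧_ (cong not unentered-i′) (cong₂ _∧_ B-i′
          (cong₂ _∧_ (cong not uncovered-i′) (Equivalence.to T-≡ (≤⇒≤ᵇ enough-covered))))

    never-queried : ∀ T t p → NeverIn t T → StrongMemory k' T → (t , p) ∉ run T (samplesWith x)
    never-queried (node M _ _ next) t p (t∉M , _) (_ , t∈M , _ , _) (here refl) = t∉M t∈M
    never-queried (node M _ _ next) t p (_ , t∉next) (_ , _ , _ , memory) (there queried) =
      never-queried (next _) t p (t∉next _) (memory _) queried

    entering-unentered-or-held : ∀ E M → (∀ l → E (wit l) ≡ false ⊎ lookup M (wit l) ≡ true) →
                                 ∀ l → entering E M (wit l) ≡ false ⊎ lookup M (wit l) ≡ true
    entering-unentered-or-held E M invariant l with lookup M (wit l) in wit-l∈M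
    ... | true  = inj₂ refl
    ... | false with invariant l
    ...   | inj₁ unentered = inj₁ (cong (_∨ false) unentered)
    ...   | inj₂ wit-l∈M′ with () ← trans (sym wit-l∈M′) wit-l∈M

    critical-at-query : ∀ M i p next E l₀ → (wit l₀ , inj₂ (pos l₀)) ≡ (i , p) →
      ∣ M ∣ ≤ k' → lookup M i ≡ true →
      (∀ l → E (wit l) ≡ false ⊎ lookup M (wit l) ≡ true) →
      ∃ λ i′ → criticalOnRun (node M i p next) E i′ x ≡ true
    critical-at-query M _ _ next E l₀ refl |M|≤k' l₀∈M invariant = from-last-leader last-leader
      where
      open AtQuery M (entering E M) l₀ |M|≤k' (λ t → ∨-introʳ (E t)) l₀∈M
                   (entering-unentered-or-held E M invariant)
      from-last-leader : (∃ λ i′ → leader i′ ≡ true × (∀ t → i′ <ᶠ t → leader t ≡ false)) →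
           ∃ λ i′ → criticalOnRun (node M (wit l₀) (inj₂ (pos l₀)) next) E i′ x ≡ true
      from-last-leader (i′ , leader-i′ , after-i′) =
        i′ , cong (_∨ criticalOnRun (next (samplesWith x (wit l₀) (inj₂ (pos l₀)))) (entering E M) i′ x)
                  (LastLeader.critical-i′ i′ leader-i′ after-i′)

    critical-on-run : ∀ T → StrongMemory k' T → ∀ E →
      (∀ l → (wit l , inj₂ (pos l)) ∈ run T (samplesWith x)) →
      (∀ l → E (wit l) ≡ false ⊎ lookup (memOf T) (wit l) ≡ true) →
      ∃ λ i′ → criticalOnRun T E i′ x ≡ true
    critical-on-run (leaf _ _) _ E queried _ with () ← queried zero
    critical-on-run (node M i p next) (|M|≤k' , i∈M , leaves , memory) E queried invariant
      with any? (λ l → Product.≡-dec _≟_ (Sum.≡-dec _≟_ _≟_) (wit l , inj₂ (pos l)) (i , p))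
    ... | yes (l₀ , at-node) =
      critical-at-query M i p next E l₀ at-node |M|≤k' ([]=⇒lookup i∈M) invariant
    ... | no none-here =
      let i′ , critical = critical-on-run (next b) (memory b) (entering E M) queried′ invariant′
      in  i′ , ∨-introʳ _ critical
      where
      b : Bool
      b = samplesWith x i p
      queried′ : ∀ l → (wit l , inj₂ (pos l)) ∈ run (next b) (samplesWith x)
      queried′ l with queried l
      ... | here at-node   = ⊥-elim (none-here (l , at-node))
      ... | there queried-l = queried-l
      left : ∀ l → lookup (memOf (next b)) (wit l) ≡ false → ¬ (memOf (next b) [ wit l ]= true)
      left l still-held held with () ← trans (sym ([]=⇒lookup held)) still-held
      invariant′ : ∀ l → entering E M (wit l) ≡ false ⊎ lookup (memOf (next b)) (wit l) ≡ true
      invariant′ l with lookup (memOf (next b)) (wit l) in still-held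
      ... | true  = inj₂ refl
      ... | false with entering-unentered-or-held E M invariant l
      ...   | inj₁ unentered = inj₁ unentered
      ...   | inj₂ was-held = ⊥-elim (never-queried (next b) (wit l) (inj₂ (pos l))
                (leaves b (wit l) (lookup⇒[]= (wit l) M was-held) (left l still-held))
                (memory b) (queried′ l))

module _ {m k s : ℕ} (k' : ℕ) (code : Fin m → Vec Bool (nLen m k))
  (ordering : Fin m → Fin (nLen m k) → Subset m) (f : Subset m → Vec Bool k) where

  open CriticalSamples {m} {s} k k' ordering (sampleBit code ordering f)

  good-unless-critical : ∀ T → StrongMemory k' T → ∀ keys → criticalSomewhere T keys ≡ false →
                         GoodEvent code ordering f k' T keys
  good-unless-critical T memory keys none A _ (g , g-injective , obtains) =
    case trans (sym (any-intro _ i′ i′-critical)) none of λ ()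
    where
    wit : Fin (suc k') → Fin s
    wit l = proj₁ (obtains l)
    pos : Fin (suc k') → Fin (nLen m k)
    pos l = proj₁ (proj₂ (obtains l))
    queried : ∀ l → (wit l , inj₂ (pos l)) ∈ run T (samplesWith keys)
    queried l = proj₁ (proj₂ (proj₂ (obtains l)))
    key∈A : ∀ l → A [ lookup keys (wit l) ]= true
    key∈A l = proj₁ (proj₂ (proj₂ (proj₂ (obtains l))))
    pos-spec : ∀ l → ordering (lookup keys (wit l)) (pos l) ≡ A - lookup keys (wit l)
    pos-spec l = proj₁ (proj₂ (proj₂ (proj₂ (proj₂ (obtains l)))))
    bit-index : ∀ l → g l ≡ ord (lookup keys (wit l)) A
    bit-index l = proj₂ (proj₂ (proj₂ (proj₂ (proj₂ (obtains l)))))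
    distinct : Injective _≡_ _≡_ (lookup keys ∘ wit)
    distinct {l} {l′} same-key =
      g-injective (trans (bit-index l) (trans (cong (λ a → ord a A) same-key) (sym (bit-index l′))))
    open ObtainedBits keys A wit pos ([]=⇒lookup ∘ key∈A) pos-spec distinct
    witness : ∃ λ i′ → criticalOnRun T (λ _ → false) i′ keys ≡ true
    witness = critical-on-run T memory (λ _ → false) queried (λ _ → inj₁ refl)
    i′ : Fin s
    i′ = proj₁ witness
    i′-critical : criticalOnRun T (λ _ → false) i′ keys ≡ true
    i′-critical = proj₂ witness

  not-good⇒critical : ∀ T → StrongMemory k' T → ∀ keys →
                      ¬ GoodEvent code ordering f k' T keys → criticalSomewhere T keys ≡ true
  not-good⇒critical T memory keys not-good with criticalSomewhere T keys in critical-keys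
  ... | true  = refl
  ... | false = ⊥-elim (not-good (good-unless-critical T memory keys critical-keys))

mainTheorem20 : (m k k' s q : ℕ) → 2 ≤ k →
    (code : Fin m → Vec Bool (nLen m k)) → GoodCode m (nLen m k) code →
    (ordering : Fin m → Fin (nLen m k) → Subset m) → IsFixedOrder m k ordering →
    (f : Subset m → Vec Bool k) →
    (r : ℕ) → 1 ≤ r → (alg : Fin r → Tree s (nLen m k)) →
    (∀ ι → StrongMemory k' (alg ι) × UsesQueries q (alg ι)) →
    Σ (List (Fin r × Vec (Fin m) s)) λ L →
      Unique L ×
      (∀ ι keys → ¬ GoodEvent code ordering f k' (alg ι) keys → (ι , keys) ∈ L) ×
      m * length L ≤ (k ∸ k') * s * q * (r * m ^ s)
mainTheorem20 m k k' s q _ code _ ordering fixed f r _ alg bounded =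
  enumeratePairs s bad , enumeratePairs-unique s bad , covers ,
  m*length-enumeratePairs≤ s bad ((k ∸ k') * s * q) λ ι →
    count-criticalSomewhere blocks q (alg ι) (proj₂ (bounded ι)) (proj₁ (bounded ι))
  where
  open CriticalSamples {m} {s} k k' ordering (sampleBit code ordering f)

  bad : Fin r → Keys → Bool
  bad ι = criticalSomewhere (alg ι)

  blocks : ∀ a j → ∣ ordering a j ∣ ≡ k ∸ 1
  blocks a j = proj₁ (IsFixedOrder.valid fixed a j)

  covers : ∀ ι keys → ¬ GoodEvent code ordering f k' (alg ι) keys → (ι , keys) ∈ enumeratePairs s bad
  covers ι keys not-good = ∈-enumeratePairs s bad ι keys
    (not-good⇒critical k' code ordering f (alg ι) (proj₁ (bounded ι)) keys not-good)
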